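{- If $M$ is a simple binary matroid with a surjective $r(M)$-colouring $c$ such that $(M,c)$ has no colour-singular elements, then $(M,c)$ contains a rainbow circuit.
   Context: An $r$-colouring of $M$ is a function $c:E(M)\to[r]$. An element is colour-singular if it is the only element of its colour class. A rainbow circuit is a circuit whose elements have pairwise distinct colours. -}

module Defs where

open import Data.Nat using (ℕ; zero; suc; _≤_)
open import Data.Bool using (Bool; true; false; _xor_; if_then_else_)
open import Data.Fin using (Fin)
import Data.Fin as Fin
open import Data.Fin.Subset using (Subset; _∈_; _⊆_; _⊂_; Nonempty; ∣_∣)
open import Data.Vec using (Vec; []; _∷_; zipWith; replicate)
open import Data.Product using (Σ; _×_; ∃; ∃-syntax)
open import Relation.Nullary using (¬_)
open import Relation.Binary.PropositionalEquality using (_≡_; _≢_)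
open import Function using (_∘_)

GF2Vec : ℕ → Set
GF2Vec n = Vec Bool n

_⊕_ : ∀ {n} → GF2Vec n → GF2Vec n → GF2Vec n
_⊕_ = zipWith _xor_

𝟎 : ∀ {n} → GF2Vec n
𝟎 = replicate _ false

-- A binary matroid on ground set E = Fin m, given by a GF(2)-representation:
-- element e is represented by the column vector rep e ∈ GF(2)^n.
BinaryMatroid : ℕ → ℕ → Set
BinaryMatroid m n = Fin m → GF2Vec n

sumSub : ∀ {m n} → BinaryMatroid m n → Subset m → GF2Vec n
sumSub {zero}  rep []      = 𝟎
sumSub {suc m} rep (b ∷ S) =
  (if b then rep Fin.zero else 𝟎) ⊕ sumSub (rep ∘ Fin.suc) S

Dependent : ∀ {m n} → BinaryMatroid m n → Subset m → Set
Dependent rep S = ∃[ T ] (T ⊆ S × Nonempty T × sumSub rep T ≡ 𝟎)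

Independent : ∀ {m n} → BinaryMatroid m n → Subset m → Set
Independent rep S = ¬ Dependent rep S

Circuit : ∀ {m n} → BinaryMatroid m n → Subset m → Set
Circuit rep C = Dependent rep C × (∀ T → T ⊂ C → Independent rep T)

IsRank : ∀ {m n} → BinaryMatroid m n → ℕ → Set
IsRank rep k =
  (∃[ S ] (Independent rep S × ∣ S ∣ ≡ k)) ×
  (∀ S → Independent rep S → ∣ S ∣ ≤ k)

-- Simple: no loops and no parallel pairs (over GF(2): distinct nonzero vectors).
Simple : ∀ {m n} → BinaryMatroid m n → Set
Simple rep = (∀ e → rep e ≢ 𝟎) × (∀ e f → rep e ≡ rep f → e ≡ f)

Colouring : ℕ → ℕ → Set
Colouring m r = Fin m → Fin r

SurjectiveColouring : ∀ {m r} → Colouring m r → Set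
SurjectiveColouring {r = r} c = ∀ (k : Fin r) → ∃[ e ] (c e ≡ k)

ColourSingular : ∀ {m r} → Colouring m r → Fin m → Set
ColourSingular c e = ∀ f → c f ≡ c e → f ≡ e

Rainbow : ∀ {m r} → Colouring m r → Subset m → Set
Rainbow c C = ∀ e f → e ∈ C → f ∈ C → c e ≡ c f → e ≡ f

-- Choose an element base a of every colour a. The set I of these elements is rainbow, so if it is
-- dependent it contains a rainbow circuit. Otherwise I is independent. Since no element is
-- colour-singular, every colour a has a second element twin a; the r(M) + 1 elements of
-- I ∪ {twin a} are dependent, so they contain a zero-sum set Y a through twin a. By simplicity
-- Y a also contains base k for some colour k ≠ a. Hence in the digraph on the colours with b → k
-- iff base k ∈ Y b every vertex has an out-neighbour other than itself, and such a digraph has a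
-- nonempty vertex set S in which every vertex has an even number of in-neighbours from S (loops
-- included): either a single loopless vertex, or a minimal set closed under out-neighbours, on
-- which the non-loop edges form a permutation. The symmetric difference Z of the Y b, b ∈ S, has
-- zero sum, contains twin a exactly for a ∈ S, and contains base k only for k ∉ S; so Z is a
-- nonempty rainbow dependent set.

module Submission where

open import Defs
open import Algebra.Bundles using (CommutativeRing)
open import Data.Bool using (Bool; true; false; _xor_; _∧_; if_then_else_)
open import Data.Bool.Properties
  using (xor-identityˡ; xor-identityʳ; xor-comm; xor-same; xor-∧-commutativeRing;
         ∧-identityʳ; ∧-zeroʳ; ∧-conicalʳ; ¬-not)
  renaming (_≟_ to _≟ᵇ_)
open import Data.Empty using (⊥-elim)
open import Data.Fin using (Fin; zero; suc; punchOut)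
open import Data.Fin.Properties
  using (_≟_; any?; all?; ¬∀⟶∃¬; suc-injective; 0≢1+n; punchOut-injective; injective⇒≤)
open import Data.Fin.Subset using (Subset; _∈_; _∉_; _⊆_; _⊂_; Nonempty; ∣_∣; ⁅_⁆; _∪_; _-_; ⊤)
open import Data.Fin.Subset.Properties
  using (_∈?_; _⊆?_; _⊂?_; nonempty?; anySubset?; ∈⊤; ⊆-refl; ⊆-trans; p⊂q⇒p⊆q;
         x∈⁅x⁆; x∈⁅y⁆⇒x≡y; x≢y⇒x∉⁅y⁆; p⊆p∪q; q⊆p∪q; x∈p∪q⁻;
         p─q⊆p; x∈p∧x≢y⇒x∈p-y; x∈p⇒p-x⊂p; x∈p⇒∣p-x∣<∣p∣)
open import Data.Fin.Subset.Induction using (⊂-wellFounded)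
open import Data.Nat using (ℕ; zero; suc; _≤_; _<_; z≤n; s≤s)
open import Data.Nat.Properties using (<-≤-trans; <⇒≱; 1+n≰n)
open import Data.Product using (_×_; _,_; proj₁; proj₂; ∃-syntax)
open import Data.Sum using (_⊎_; inj₁; inj₂)
open import Data.Vec using (Vec; []; _∷_; lookup; tabulate; there)
open import Data.Vec.Properties
  using (lookup-zipWith; lookup-replicate; tabulate∘lookup; tabulate-cong; lookup∘tabulate;
         []=⇒lookup; lookup⇒[]=; zipWith-identityˡ; zipWith-identityʳ; ≡-dec)
open import Function using (_∘_)
open import Function.Definitions using (Injective)
open import Induction.WellFounded using (Acc; acc)
open import Level using (Level)
open import Relation.Nullary using (¬_; Dec; yes; no; does; contradiction)
open import Relation.Nullary.Decidable
  using (_×-dec_; _→-dec_; _⊎-dec_; ¬?; dec-true; decidable-stable)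
open import Relation.Binary.PropositionalEquality
  using (_≡_; _≢_; refl; sym; trans; cong; cong₂; subst; module ≡-Reasoning)
open import Relation.Unary using (Pred; Decidable)

open import Algebra.Properties.CommutativeSemigroup
  (CommutativeRing.+-commutativeSemigroup xor-∧-commutativeRing)
  using () renaming (interchange to xor-interchange)

open ≡-Reasoning

private
  variable
    ℓ : Level
    k m n r : ℕ

lookup-extensionality : ∀ {A : Set} {xs ys : Vec A n} →
  (∀ i → lookup xs i ≡ lookup ys i) → xs ≡ ys
lookup-extensionality {xs = xs} {ys} eq =
  trans (sym (tabulate∘lookup xs)) (trans (tabulate-cong eq) (tabulate∘lookup ys))

⊕-identityˡ : (x : GF2Vec n) → 𝟎 ⊕ x ≡ x
⊕-identityˡ = zipWith-identityˡ xor-identityˡ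

⊕-identityʳ : (x : GF2Vec n) → x ⊕ 𝟎 ≡ x
⊕-identityʳ = zipWith-identityʳ xor-identityʳ

⊕-self : (x : GF2Vec n) → x ⊕ x ≡ 𝟎
⊕-self []       = refl
⊕-self (a ∷ xs) = cong₂ _∷_ (xor-same a) (⊕-self xs)

⊕-interchange : (w x y z : GF2Vec n) → (w ⊕ x) ⊕ (y ⊕ z) ≡ (w ⊕ y) ⊕ (x ⊕ z)
⊕-interchange []       []       []       []       = refl
⊕-interchange (a ∷ ws) (b ∷ xs) (c ∷ ys) (d ∷ zs) =
  cong₂ _∷_ (xor-interchange a b c d) (⊕-interchange ws xs ys zs)

xor≡false⇒≡ : ∀ {a b} → a xor b ≡ false → a ≡ b
xor≡false⇒≡ {false}         eq = sym eq
xor≡false⇒≡ {true}  {false} ()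
xor≡false⇒≡ {true}  {true}  _  = refl

parity : (Fin r → Bool) → Bool
parity {zero}  P = false
parity {suc r} P = P zero xor parity (P ∘ suc)

parity-false : {P : Fin r → Bool} → (∀ b → P b ≡ false) → parity P ≡ false
parity-false {zero}      _        = refl
parity-false {suc r} {P} P≡false rewrite P≡false zero = parity-false (P≡false ∘ suc)

parity-single : {P : Fin r → Bool} (a : Fin r) →
  (∀ b → b ≢ a → P b ≡ false) → parity P ≡ P a
parity-single {suc r} {P} zero    elsewhere =
  trans (cong (P zero xor_) (parity-false (λ b → elsewhere (suc b) (0≢1+n ∘ sym))))
        (xor-identityʳ (P zero))
parity-single {suc r} {P} (suc a) elsewhere rewrite elsewhere zero 0≢1+n =
  parity-single a (λ b b≢a → elsewhere (suc b) (b≢a ∘ suc-injective))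

parity-pair : {P : Fin r → Bool} {a a′ : Fin r} → a ≢ a′ →
  (∀ b → b ≢ a → b ≢ a′ → P b ≡ false) → parity P ≡ P a xor P a′
parity-pair {suc r} {P} {zero}  {zero}   a≢a′ _ = contradiction refl a≢a′
parity-pair {suc r} {P} {zero}  {suc a′} _ elsewhere =
  cong (P zero xor_)
    (parity-single a′ (λ b b≢a′ → elsewhere (suc b) (0≢1+n ∘ sym) (b≢a′ ∘ suc-injective)))
parity-pair {suc r} {P} {suc a} {zero}   _ elsewhere =
  trans (cong (P zero xor_)
          (parity-single a (λ b b≢a → elsewhere (suc b) (b≢a ∘ suc-injective) (0≢1+n ∘ sym))))
        (xor-comm (P zero) (P (suc a)))
parity-pair {suc r} {P} {suc a} {suc a′} a≢a′ elsewhere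
  rewrite elsewhere zero 0≢1+n 0≢1+n =
  parity-pair (a≢a′ ∘ cong suc)
    (λ b b≢a b≢a′ → elsewhere (suc b) (b≢a ∘ suc-injective) (b≢a′ ∘ suc-injective))

parity≡true⇒∃ : {P : Fin r → Bool} → parity P ≡ true → ∃[ b ] P b ≡ true
parity≡true⇒∃ {suc r} {P} odd with P zero in P₀
... | true  = zero , P₀
... | false = let b , Pb = parity≡true⇒∃ odd in suc b , Pb

lookup-sumSub : (F : Fin m → GF2Vec k) (S : Subset m) (i : Fin k) →
  lookup (sumSub F S) i ≡ parity (λ b → lookup S b ∧ lookup (F b) i)
lookup-sumSub {zero}  F []      i = lookup-replicate i false
lookup-sumSub {suc m} F (s ∷ S) i =
  trans (lookup-zipWith _xor_ i (if s then F zero else 𝟎) (sumSub (F ∘ suc) S))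
        (cong₂ _xor_ (lookup-if s) (lookup-sumSub (F ∘ suc) S i))
  where
  lookup-if : ∀ s → lookup (if s then F zero else 𝟎) i ≡ s ∧ lookup (F zero) i
  lookup-if true  = refl
  lookup-if false = lookup-replicate i false

sumSub-⊥ : (F : Fin m → GF2Vec k) → sumSub F 𝟎 ≡ 𝟎
sumSub-⊥ {zero}  F = refl
sumSub-⊥ {suc m} F = trans (⊕-identityˡ _) (sumSub-⊥ (F ∘ suc))

sumSub-vanishing : (F : Fin m → GF2Vec k) (S : Subset m) → (∀ b → F b ≡ 𝟎) → sumSub F S ≡ 𝟎
sumSub-vanishing {zero}  F []      _   = refl
sumSub-vanishing {suc m} F (s ∷ S) F≡𝟎 =
  trans (cong₂ _⊕_ (if-𝟎 s) (sumSub-vanishing (F ∘ suc) S (F≡𝟎 ∘ suc))) (⊕-identityˡ 𝟎)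
  where
  if-𝟎 : ∀ s → (if s then F zero else 𝟎) ≡ 𝟎
  if-𝟎 true  = F≡𝟎 zero
  if-𝟎 false = refl

sumSub-⊕ : (F : Fin m → GF2Vec k) (S S′ : Subset m) →
  sumSub F (S ⊕ S′) ≡ sumSub F S ⊕ sumSub F S′
sumSub-⊕ {zero}  F []      []        = sym (⊕-identityˡ 𝟎)
sumSub-⊕ {suc m} F (s ∷ S) (s′ ∷ S′) =
  trans (cong₂ _⊕_ (if-xor s s′) (sumSub-⊕ (F ∘ suc) S S′)) (⊕-interchange _ _ _ _)
  where
  if-xor : ∀ s s′ → (if s xor s′ then F zero else 𝟎) ≡
                    (if s then F zero else 𝟎) ⊕ (if s′ then F zero else 𝟎)
  if-xor false false = sym (⊕-identityˡ 𝟎)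
  if-xor false true  = sym (⊕-identityˡ (F zero))
  if-xor true  false = sym (⊕-identityʳ (F zero))
  if-xor true  true  = sym (⊕-self (F zero))

sumSub-sumSub : (F : Fin k → GF2Vec n) (G : Fin m → GF2Vec k) (S : Subset m) →
  sumSub F (sumSub G S) ≡ sumSub (sumSub F ∘ G) S
sumSub-sumSub {m = zero}  F G []      = sumSub-⊥ F
sumSub-sumSub {m = suc m} F G (s ∷ S) =
  trans (sumSub-⊕ F _ _) (cong₂ _⊕_ (sumSub-if s) (sumSub-sumSub F (G ∘ suc) S))
  where
  sumSub-if : ∀ s → sumSub F (if s then G zero else 𝟎) ≡ (if s then sumSub F (G zero) else 𝟎)
  sumSub-if true  = refl
  sumSub-if false = sumSub-⊥ F

¬∀→⇒∃×¬ : {P Q : Pred (Fin n) ℓ} → Decidable P → Decidable Q →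
  ¬ (∀ i → P i → Q i) → ∃[ i ] (P i × ¬ Q i)
¬∀→⇒∃×¬ P? Q? ¬P⇒Q with ¬∀⟶∃¬ _ _ (λ i → P? i →-dec Q? i) ¬P⇒Q
... | i , ¬[Pi→Qi] with P? i
...   | yes Pi = i , Pi , λ Qi → ¬[Pi→Qi] (λ _ → Qi)
...   | no ¬Pi = contradiction (λ Pi → contradiction Pi ¬Pi) ¬[Pi→Qi]

injective⇒surjective : {f : Fin n → Fin n} → Injective _≡_ _≡_ f → ∀ y → ∃[ x ] f x ≡ y
injective⇒surjective {suc n} {f} f-injective y with any? (λ x → f x ≟ y)
... | yes hit = hit
... | no miss = contradiction (injective⇒≤ {f = squeeze} squeeze-injective) 1+n≰n
  where
  avoid : ∀ x → y ≢ f x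
  avoid x y≡fx = miss (x , sym y≡fx)

  squeeze : Fin (suc n) → Fin n
  squeeze x = punchOut (avoid x)

  squeeze-injective : Injective _≡_ _≡_ squeeze
  squeeze-injective = f-injective ∘ punchOut-injective (avoid _) (avoid _)

∉⇒lookup≡false : {p : Subset n} {x : Fin n} → x ∉ p → lookup p x ≡ false
∉⇒lookup≡false {p = p} {x} x∉p = ¬-not (x∉p ∘ lookup⇒[]= x p)

x∉p-x : (p : Subset n) (x : Fin n) → x ∉ p - x
x∉p-x (_ ∷ p) zero    ()
x∉p-x (_ ∷ p) (suc x) (there x∈p-x) = x∉p-x p x x∈p-x

x∈p-y⇒x≢y : {p : Subset n} {x y : Fin n} → x ∈ p - y → x ≢ y
x∈p-y⇒x≢y {p = p} x∈p-y refl = x∉p-x p _ x∈p-y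

subsetOf : {P : Pred (Fin n) ℓ} → Decidable P → Subset n
subsetOf P? = tabulate (does ∘ P?)

∈-subsetOf⁺ : {P : Pred (Fin n) ℓ} (P? : Decidable P) {x : Fin n} → P x → x ∈ subsetOf P?
∈-subsetOf⁺ P? {x} Px =
  lookup⇒[]= x (subsetOf P?) (trans (lookup∘tabulate (does ∘ P?) x) (dec-true (P? x) Px))

∈-subsetOf⁻ : {P : Pred (Fin n) ℓ} (P? : Decidable P) {x : Fin n} → x ∈ subsetOf P? → P x
∈-subsetOf⁻ P? {x} x∈ with P? x | trans (sym (lookup∘tabulate (does ∘ P?) x)) ([]=⇒lookup x∈)
... | yes Px | _ = Px
... | no _   | ()

injective⇒≤∣p∣ : (p : Subset m) (g : Fin k → Fin m) → Injective _≡_ _≡_ g →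
  (∀ i → g i ∈ p) → k ≤ ∣ p ∣
injective⇒≤∣p∣ {k = zero}  p g _           _   = z≤n
injective⇒≤∣p∣ {k = suc k} p g g-injective g∈p =
  <-≤-trans (s≤s (injective⇒≤∣p∣ (p - g zero) (g ∘ suc) (suc-injective ∘ g-injective) g∘suc∈))
            (x∈p⇒∣p-x∣<∣p∣ (g∈p zero))
  where
  g∘suc∈ : ∀ i → g (suc i) ∈ p - g zero
  g∘suc∈ i = x∈p∧x≢y⇒x∈p-y (g∈p (suc i)) (0≢1+n ∘ g-injective ∘ sym)

Minimal : Pred (Subset n) ℓ → Pred (Subset n) ℓ
Minimal P S = P S × (∀ T → T ⊂ S → ¬ P T)

minimal-⊆ : {P : Pred (Subset n) ℓ} → Decidable P → ∀ {S} → P S → ∃[ S′ ] (S′ ⊆ S × Minimal P S′)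
minimal-⊆ {P = P} P? {S} PS = go (⊂-wellFounded S) PS
  where
  go : ∀ {S} → Acc _⊂_ S → P S → ∃[ S′ ] (S′ ⊆ S × Minimal P S′)
  go {S} (acc smaller) PS with anySubset? (λ T → T ⊂? S ×-dec P? T)
  ... | yes (T , T⊂S , PT) =
    let S′ , S′⊆T , minimal = go (smaller T⊂S) PT in S′ , ⊆-trans S′⊆T (p⊂q⇒p⊆q T⊂S) , minimal
  ... | no ∄T = S , ⊆-refl , PS , λ T T⊂S PT → ∄T (T , T⊂S , PT)

-- Binary matroids

module _ (M : BinaryMatroid m n) where

  dependent? : Decidable (Dependent M)
  dependent? S =
    anySubset? (λ T → T ⊆? S ×-dec nonempty? T ×-dec ≡-dec _≟ᵇ_ (sumSub M T) 𝟎)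

  dependent⇒⊇circuit : ∀ {S} → Dependent M S → ∃[ C ] (C ⊆ S × Circuit M C)
  dependent⇒⊇circuit = minimal-⊆ dependent?

  large⇒dependent : (∀ S → Independent M S → ∣ S ∣ ≤ r) → ∀ {S} → r < ∣ S ∣ → Dependent M S
  large⇒dependent rank≤ {S} r<∣S∣ with dependent? S
  ... | yes dependent   = dependent
  ... | no  independent = contradiction (rank≤ S independent) (<⇒≱ r<∣S∣)

  zeroSumThrough : ∀ {I x} → Independent M I → Dependent M (I ∪ ⁅ x ⁆) →
    ∃[ U ] (U ⊆ I ∪ ⁅ x ⁆ × x ∈ U × sumSub M U ≡ 𝟎)
  zeroSumThrough {I} {x} independent (U , U⊆ , U≠∅ , U≡𝟎) with x ∈? U
  ... | yes x∈U = U , U⊆ , x∈U , U≡𝟎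
  ... | no  x∉U = ⊥-elim (independent (U , U⊆I , U≠∅ , U≡𝟎))
    where
    U⊆I : U ⊆ I
    U⊆I {y} y∈U with x∈p∪q⁻ I ⁅ x ⁆ (U⊆ y∈U)
    ... | inj₁ y∈I     = y∈I
    ... | inj₂ y∈⁅x⁆ = contradiction (subst (_∈ U) (x∈⁅y⁆⇒x≡y x y∈⁅x⁆) y∈U) x∉U

  zeroSum⊆pair : ∀ {U p q} → p ≢ q → p ∈ U → (∀ x → x ∈ U → x ≡ p ⊎ x ≡ q) →
    sumSub M U ≡ 𝟎 → M p ≡ 𝟎 ⊎ M p ≡ M q
  zeroSum⊆pair {U} {p} {q} p≢q p∈U ⊆pq U≡𝟎 = by-membership-of-q (lookup U q) coordinate
    where
    outside-pair : ∀ i x → x ≢ p → x ≢ q → lookup U x ∧ lookup (M x) i ≡ false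
    outside-pair i x x≢p x≢q with lookup U x in x∈U
    ... | false = refl
    ... | true with ⊆pq x (lookup⇒[]= x U x∈U)
    ...   | inj₁ x≡p = contradiction x≡p x≢p
    ...   | inj₂ x≡q = contradiction x≡q x≢q

    coordinate : ∀ i → lookup (M p) i ≡ lookup U q ∧ lookup (M q) i
    coordinate i = xor≡false⇒≡ (begin
      lookup (M p) i xor (lookup U q ∧ lookup (M q) i)
        ≡⟨ cong (λ u → (u ∧ lookup (M p) i) xor _) (sym ([]=⇒lookup p∈U)) ⟩
      (lookup U p ∧ lookup (M p) i) xor (lookup U q ∧ lookup (M q) i)
        ≡⟨ sym (parity-pair p≢q (outside-pair i)) ⟩
      parity (λ x → lookup U x ∧ lookup (M x) i)
        ≡⟨ sym (lookup-sumSub M U i) ⟩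
      lookup (sumSub M U) i
        ≡⟨ cong (λ v → lookup v i) U≡𝟎 ⟩
      lookup 𝟎 i
        ≡⟨ lookup-replicate i false ⟩
      false ∎)

    by-membership-of-q : ∀ u → (∀ i → lookup (M p) i ≡ u ∧ lookup (M q) i) → M p ≡ 𝟎 ⊎ M p ≡ M q
    by-membership-of-q false Mp≡ = inj₁ (lookup-extensionality λ i →
                                     trans (Mp≡ i) (sym (lookup-replicate i false)))
    by-membership-of-q true  Mp≡ = inj₂ (lookup-extensionality Mp≡)

  simple⇒zeroSum-has-third : Simple M → ∀ {U p q} → p ≢ q → p ∈ U → sumSub M U ≡ 𝟎 →
    ∃[ x ] (x ∈ U × ¬ (x ≡ p ⊎ x ≡ q))
  simple⇒zeroSum-has-third (loopless , parallel⇒≡) {U} {p} {q} p≢q p∈U U≡𝟎 =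
    ¬∀→⇒∃×¬ (_∈? U) (λ x → x ≟ p ⊎-dec x ≟ q) inside-pair-impossible
    where
    inside-pair-impossible : ¬ (∀ x → x ∈ U → x ≡ p ⊎ x ≡ q)
    inside-pair-impossible ⊆pq with zeroSum⊆pair p≢q p∈U ⊆pq U≡𝟎
    ... | inj₁ Mp≡𝟎  = loopless p Mp≡𝟎
    ... | inj₂ Mp≡Mq = p≢q (parallel⇒≡ p q Mp≡Mq)

module _ {c : Colouring m r} where

  rainbow-⊆ : ∀ {C S} → C ⊆ S → Rainbow c S → Rainbow c C
  rainbow-⊆ C⊆S rainbow e f e∈C f∈C = rainbow e f (C⊆S e∈C) (C⊆S f∈C)

  rainbowDependent⇒rainbowCircuit : (M : BinaryMatroid m n) → ∀ {S} → Rainbow c S →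
    Dependent M S → ∃[ C ] (Circuit M C × Rainbow c C)
  rainbowDependent⇒rainbowCircuit M rainbow dependent =
    let C , C⊆S , circuit = dependent⇒⊇circuit M dependent in C , circuit , rainbow-⊆ C⊆S rainbow

  rainbow-by-sections : ∀ {Z} (s t : Fin r → Fin m) →
    (∀ x → x ∈ Z → x ≡ s (c x) ⊎ x ≡ t (c x)) →
    (∀ a → s a ∈ Z → t a ∈ Z → s a ≡ t a) → Rainbow c Z
  rainbow-by-sections {Z} s t shape s≡t e f e∈Z f∈Z ce≡cf = same-colour (shape e e∈Z) (shape f f∈Z)
    where
    s-t : ∀ {e f} → e ≡ s (c e) → f ≡ t (c f) → e ∈ Z → f ∈ Z → c e ≡ c f → e ≡ f
    s-t {e} {f} e≡s f≡t e∈Z f∈Z ce≡cf = begin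
      e         ≡⟨ e≡s ⟩
      s (c e)   ≡⟨ s≡t (c e) (subst (_∈ Z) e≡s e∈Z) (subst (_∈ Z) f≡t′ f∈Z) ⟩
      t (c e)   ≡⟨ sym f≡t′ ⟩
      f         ∎
      where
      f≡t′ : f ≡ t (c e)
      f≡t′ = trans f≡t (cong t (sym ce≡cf))

    same-colour : e ≡ s (c e) ⊎ e ≡ t (c e) → f ≡ s (c f) ⊎ f ≡ t (c f) → e ≡ f
    same-colour (inj₁ e≡s) (inj₁ f≡s) = trans e≡s (trans (cong s ce≡cf) (sym f≡s))
    same-colour (inj₂ e≡t) (inj₂ f≡t) = trans e≡t (trans (cong t ce≡cf) (sym f≡t))
    same-colour (inj₁ e≡s) (inj₂ f≡t) = s-t e≡s f≡t e∈Z f∈Z ce≡cf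
    same-colour (inj₂ e≡t) (inj₁ f≡s) = sym (s-t f≡s e≡t f∈Z e∈Z (sym ce≡cf))

record ColourTwins (c : Colouring m r) : Set where
  field
    base twin   : Fin r → Fin m
    base-colour : ∀ a → c (base a) ≡ a
    twin-colour : ∀ a → c (twin a) ≡ a
    twin≢base   : ∀ a → twin a ≢ base a

colourTwins : {c : Colouring m r} → SurjectiveColouring c → (∀ e → ¬ ColourSingular c e) →
  ColourTwins c
colourTwins {m} {r} {c} surjective nonsingular = record
  { base        = base
  ; twin        = proj₁ ∘ other
  ; base-colour = base-colour
  ; twin-colour = λ a → trans (proj₁ (proj₂ (other a))) (base-colour a)
  ; twin≢base   = proj₂ ∘ proj₂ ∘ other
  }
  where
  base : Fin r → Fin m
  base = proj₁ ∘ surjective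

  base-colour : ∀ a → c (base a) ≡ a
  base-colour = proj₂ ∘ surjective

  other : ∀ a → ∃[ f ] (c f ≡ c (base a) × f ≢ base a)
  other a = ¬∀→⇒∃×¬ (λ f → c f ≟ c (base a)) (_≟ base a) (nonsingular (base a))

-- Digraphs with loops

module Digraph (E : Fin r → Fin r → Bool) where

  -- b = a is included, so a loop at a counts as an in-neighbour.
  inParity : Subset r → Fin r → Bool
  inParity S a = parity (λ b → lookup S b ∧ E b a)

  InEven : Subset r → Set
  InEven S = ∀ a → a ∈ S → inParity S a ≡ false

  HasSuccessorIn : Subset r → Fin r → Set
  HasSuccessorIn S a = ∃[ k ] (k ∈ S × k ≢ a × E a k ≡ true)

  hasSuccessorIn? : ∀ S → Decidable (HasSuccessorIn S)
  hasSuccessorIn? S a = any? (λ k → k ∈? S ×-dec ¬? (k ≟ a) ×-dec E a k ≟ᵇ true)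

  Closed : Subset r → Set
  Closed S = ∀ a → a ∈ S → HasSuccessorIn S a

  closed? : Decidable Closed
  closed? S = all? (λ a → a ∈? S →-dec hasSuccessorIn? S a)

  loopless⇒inEven : ∀ {a} → E a a ≡ false → InEven ⁅ a ⁆
  loopless⇒inEven {a} Eaa≡false a′ a′∈⁅a⁆ rewrite x∈⁅y⁆⇒x≡y a a′∈⁅a⁆ = begin
    inParity ⁅ a ⁆ a        ≡⟨ parity-single a only-a ⟩
    lookup ⁅ a ⁆ a ∧ E a a  ≡⟨ cong₂ _∧_ ([]=⇒lookup (x∈⁅x⁆ a)) Eaa≡false ⟩
    false                   ∎
    where
    only-a : ∀ b → b ≢ a → lookup ⁅ a ⁆ b ∧ E b a ≡ false
    only-a b b≢a = cong (_∧ E b a) (∉⇒lookup≡false (x≢y⇒x∉⁅y⁆ b≢a))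

  module MinimalClosed (loops : ∀ a → E a a ≡ true)
    {S : Subset r} (minimal : Minimal (λ S → Nonempty S × Closed S) S) where

    closed : Closed S
    closed = proj₂ (proj₁ minimal)

    SoleSuccessor : Fin r → Fin r → Set
    SoleSuccessor j a = E j a ≡ true × (∀ k → k ∈ S → k ≢ j → E j k ≡ true → k ≡ a)

    -- S - a is nonempty (it contains a's successor) and smaller than S, so it is not closed; a
    -- vertex without successor in S - a can leave it only towards a.
    soleSuccessor : ∀ {a} → a ∈ S → ∃[ j ] (j ∈ S × j ≢ a × SoleSuccessor j a)
    soleSuccessor {a} a∈S = j , j∈S , j≢a , Eja , only-a
      where
      S-a-not-closed : ¬ Closed (S - a)
      S-a-not-closed closed′ =
        let k , k∈S , k≢a , _ = closed a a∈S
        in proj₂ minimal (S - a) (x∈p⇒p-x⊂p a∈S) ((k , x∈p∧x≢y⇒x∈p-y k∈S k≢a) , closed′)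

      stuck : ∃[ j ] (j ∈ S - a × ¬ HasSuccessorIn (S - a) j)
      stuck = ¬∀→⇒∃×¬ (_∈? S - a) (hasSuccessorIn? (S - a)) S-a-not-closed

      j : Fin r
      j = proj₁ stuck

      j∈S : j ∈ S
      j∈S = p─q⊆p S ⁅ a ⁆ (proj₁ (proj₂ stuck))

      j≢a : j ≢ a
      j≢a = x∈p-y⇒x≢y (proj₁ (proj₂ stuck))

      only-a : ∀ k → k ∈ S → k ≢ j → E j k ≡ true → k ≡ a
      only-a k k∈S k≢j Ejk with k ≟ a
      ... | yes k≡a = k≡a
      ... | no  k≢a = contradiction (k , x∈p∧x≢y⇒x∈p-y k∈S k≢a , k≢j , Ejk) (proj₂ (proj₂ stuck))

      Eja : E j a ≡ true
      Eja = let k , k∈S , k≢j , Ejk = closed j j∈S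
            in subst (λ k → E j k ≡ true) (only-a k k∈S k≢j Ejk) Ejk

    -- Extended by the identity off S, J is an injection of Fin r, hence onto S by pigeonhole.
    J : Fin r → Fin r
    J a with a ∈? S
    ... | yes a∈S = proj₁ (soleSuccessor a∈S)
    ... | no  _   = a

    J-inside : ∀ {a} → a ∈ S → J a ∈ S × J a ≢ a × SoleSuccessor (J a) a
    J-inside {a} a∈S with a ∈? S
    ... | yes a∈S′ = proj₂ (soleSuccessor a∈S′)
    ... | no  a∉S  = contradiction a∈S a∉S

    J∈S : ∀ {a} → a ∈ S → J a ∈ S
    J∈S a∈S = proj₁ (J-inside a∈S)

    J≢ : ∀ {a} → a ∈ S → J a ≢ a
    J≢ a∈S = proj₁ (proj₂ (J-inside a∈S))

    J-edge : ∀ {a} → a ∈ S → E (J a) a ≡ true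
    J-edge a∈S = proj₁ (proj₂ (proj₂ (J-inside a∈S)))

    J-sole : ∀ {a} → a ∈ S → ∀ k → k ∈ S → k ≢ J a → E (J a) k ≡ true → k ≡ a
    J-sole a∈S = proj₂ (proj₂ (proj₂ (J-inside a∈S)))

    J-outside : ∀ {a} → a ∉ S → J a ≡ a
    J-outside {a} a∉S with a ∈? S
    ... | yes a∈S = contradiction a∈S a∉S
    ... | no  _   = refl

    J-injective : Injective _≡_ _≡_ J
    J-injective {a} {a′} = by-membership (a ∈? S) (a′ ∈? S)
      where
      by-membership : Dec (a ∈ S) → Dec (a′ ∈ S) → J a ≡ J a′ → a ≡ a′
      by-membership (yes a∈S) (yes a′∈S) Ja≡Ja′ =
        sym (J-sole a∈S a′ a′∈S (λ a′≡Ja → J≢ a′∈S (trans (sym Ja≡Ja′) (sym a′≡Ja)))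
                                (subst (λ j → E j a′ ≡ true) (sym Ja≡Ja′) (J-edge a′∈S)))
      by-membership (yes a∈S) (no a′∉S) Ja≡Ja′ =
        contradiction (subst (_∈ S) (trans Ja≡Ja′ (J-outside a′∉S)) (J∈S a∈S)) a′∉S
      by-membership (no a∉S) (yes a′∈S) Ja≡Ja′ =
        contradiction (subst (_∈ S) (trans (sym Ja≡Ja′) (J-outside a∉S)) (J∈S a′∈S)) a∉S
      by-membership (no a∉S) (no a′∉S) Ja≡Ja′ =
        trans (sym (J-outside a∉S)) (trans Ja≡Ja′ (J-outside a′∉S))

    J-preimage∈S : ∀ {a} → J a ∈ S → a ∈ S
    J-preimage∈S {a} Ja∈S =
      decidable-stable (a ∈? S) (λ a∉S → a∉S (subst (_∈ S) (J-outside a∉S) Ja∈S))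

    inNeighbour≡J : ∀ {k b} → k ∈ S → b ∈ S → b ≢ k → E b k ≡ true → b ≡ J k
    inNeighbour≡J {k} {b} k∈S b∈S b≢k Ebk with injective⇒surjective J-injective b
    ... | a , refl = cong J (sym (J-sole (J-preimage∈S {a} b∈S) k k∈S (b≢k ∘ sym) Ebk))

    inEven : InEven S
    inEven k k∈S = begin
      inParity S k
        ≡⟨ parity-pair (J≢ k∈S ∘ sym) no-other-inNeighbour ⟩
      (lookup S k ∧ E k k) xor (lookup S (J k) ∧ E (J k) k)
        ≡⟨ cong₂ _xor_ (cong₂ _∧_ ([]=⇒lookup k∈S) (loops k))
                       (cong₂ _∧_ ([]=⇒lookup (J∈S k∈S)) (J-edge k∈S)) ⟩
      false ∎
      where
      no-other-inNeighbour : ∀ b → b ≢ k → b ≢ J k → lookup S b ∧ E b k ≡ false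
      no-other-inNeighbour b b≢k b≢Jk with lookup S b in b∈S | E b k in Ebk
      ... | true  | true  = contradiction (inNeighbour≡J k∈S (lookup⇒[]= b S b∈S) b≢k Ebk) b≢Jk
      ... | true  | false = refl
      ... | false | _     = refl

  nonempty-inEven-subset : Closed ⊤ → Fin r → ∃[ S ] (Nonempty S × InEven S)
  nonempty-inEven-subset closed⊤ a₀ with any? (λ a → E a a ≟ᵇ false)
  ... | yes (a , Eaa≡false) = ⁅ a ⁆ , (a , x∈⁅x⁆ a) , loopless⇒inEven Eaa≡false
  ... | no  ∄loopless =
    let S , _ , minimal = minimal-⊆ (λ S → nonempty? S ×-dec closed? S) ((a₀ , ∈⊤) , closed⊤)
    in S , proj₁ (proj₁ minimal) , MinimalClosed.inEven loops minimal
    where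
    loops : ∀ a → E a a ≡ true
    loops a = ¬-not (∄loopless ∘ (a ,_))

-- Rainbow circuits

module _ (M : BinaryMatroid m n) (simple : Simple M) (rank≤ : ∀ S → Independent M S → ∣ S ∣ ≤ r)
         {c : Colouring m r} (twins : ColourTwins c) where

  open ColourTwins twins

  base-injective : Injective _≡_ _≡_ base
  base-injective {k} {k′} eq = trans (sym (base-colour k)) (trans (cong c eq) (base-colour k′))

  twin-injective : Injective _≡_ _≡_ twin
  twin-injective {k} {k′} eq = trans (sym (twin-colour k)) (trans (cong c eq) (twin-colour k′))

  twin≢anyBase : ∀ a k → twin a ≢ base k
  twin≢anyBase a k eq = twin≢base a (trans eq (cong base k≡a))
    where
    k≡a : k ≡ a
    k≡a = trans (sym (base-colour k)) (trans (cong c (sym eq)) (twin-colour a))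

  -- The image of base, described using that base is a section of c.
  I : Subset m
  I = subsetOf (λ x → x ≟ base (c x))

  base∈I : ∀ a → base a ∈ I
  base∈I a = ∈-subsetOf⁺ (λ x → x ≟ base (c x)) (cong base (sym (base-colour a)))

  ∈I⇒≡base : ∀ {x} → x ∈ I → x ≡ base (c x)
  ∈I⇒≡base = ∈-subsetOf⁻ (λ x → x ≟ base (c x))

  I-rainbow : Rainbow c I
  I-rainbow = rainbow-by-sections base base (λ _ x∈I → inj₁ (∈I⇒≡base x∈I)) (λ _ _ _ → refl)

  module _ (I-independent : Independent M I) where

    I∪twin-dependent : ∀ a → Dependent M (I ∪ ⁅ twin a ⁆)
    I∪twin-dependent a = large⇒dependent M rank≤ (injective⇒≤∣p∣ _ g g-injective g∈)
      where
      g : Fin (suc r) → Fin m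
      g zero    = twin a
      g (suc k) = base k

      g-injective : Injective _≡_ _≡_ g
      g-injective {zero}  {zero}   _  = refl
      g-injective {zero}  {suc k}  eq = contradiction eq (twin≢anyBase a k)
      g-injective {suc k} {zero}   eq = contradiction (sym eq) (twin≢anyBase a k)
      g-injective {suc k} {suc k′} eq = cong suc (base-injective eq)

      g∈ : ∀ i → g i ∈ I ∪ ⁅ twin a ⁆
      g∈ zero    = q⊆p∪q I ⁅ twin a ⁆ (x∈⁅x⁆ (twin a))
      g∈ (suc k) = p⊆p∪q ⁅ twin a ⁆ (base∈I k)

    Y-spec : ∀ a → ∃[ U ] (U ⊆ I ∪ ⁅ twin a ⁆ × twin a ∈ U × sumSub M U ≡ 𝟎)
    Y-spec a = zeroSumThrough M I-independent (I∪twin-dependent a)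

    Y : Fin r → Subset m
    Y a = proj₁ (Y-spec a)

    twin∈Y : ∀ a → twin a ∈ Y a
    twin∈Y a = proj₁ (proj₂ (proj₂ (Y-spec a)))

    Y-zeroSum : ∀ a → sumSub M (Y a) ≡ 𝟎
    Y-zeroSum a = proj₂ (proj₂ (proj₂ (Y-spec a)))

    Y-shape : ∀ a {x} → x ∈ Y a → x ≡ base (c x) ⊎ x ≡ twin a
    Y-shape a {x} x∈Y with x∈p∪q⁻ I ⁅ twin a ⁆ (proj₁ (proj₂ (Y-spec a)) x∈Y)
    ... | inj₁ x∈I      = inj₁ (∈I⇒≡base x∈I)
    ... | inj₂ x∈⁅twin⁆ = inj₂ (x∈⁅y⁆⇒x≡y (twin a) x∈⁅twin⁆)

    twin∈Y⇒≡ : ∀ {a b} → twin a ∈ Y b → b ≡ a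
    twin∈Y⇒≡ {a} {b} twin∈Yb with Y-shape b twin∈Yb
    ... | inj₁ twin≡base = contradiction twin≡base (twin≢anyBase a (c (twin a)))
    ... | inj₂ twin≡twin = twin-injective (sym twin≡twin)

    E : Fin r → Fin r → Bool
    E b k = lookup (Y b) (base k)

    open Digraph E

    every-colour-has-successor : Closed ⊤
    every-colour-has-successor a _
      with simple⇒zeroSum-has-third M simple (twin≢base a) (twin∈Y a) (Y-zeroSum a)
    ... | x , x∈Y , x∉pair with Y-shape a x∈Y
    ...   | inj₂ x≡twin = contradiction (inj₁ x≡twin) x∉pair
    ...   | inj₁ x≡base =
      c x , ∈⊤ , (λ cx≡a → x∉pair (inj₂ (trans x≡base (cong base cx≡a))))
          , []=⇒lookup (subst (_∈ Y a) x≡base x∈Y)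

    module _ {S : Subset r} (S-inEven : InEven S) where

      Z : Subset m
      Z = sumSub Y S

      lookup-Z-twin : ∀ a → lookup Z (twin a) ≡ lookup S a
      lookup-Z-twin a = begin
        lookup Z (twin a)
          ≡⟨ lookup-sumSub Y S (twin a) ⟩
        parity (λ b → lookup S b ∧ lookup (Y b) (twin a))
          ≡⟨ parity-single a only-a ⟩
        lookup S a ∧ lookup (Y a) (twin a)
          ≡⟨ cong (lookup S a ∧_) ([]=⇒lookup (twin∈Y a)) ⟩
        lookup S a ∧ true
          ≡⟨ ∧-identityʳ (lookup S a) ⟩
        lookup S a ∎
        where
        only-a : ∀ b → b ≢ a → lookup S b ∧ lookup (Y b) (twin a) ≡ false
        only-a b b≢a = trans (cong (lookup S b ∧_) (∉⇒lookup≡false (b≢a ∘ twin∈Y⇒≡)))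
                             (∧-zeroʳ (lookup S b))

      Z-shape : ∀ x → x ∈ Z → x ≡ base (c x) ⊎ x ≡ twin (c x)
      Z-shape x x∈Z with parity≡true⇒∃ (trans (sym (lookup-sumSub Y S x)) ([]=⇒lookup x∈Z))
      ... | b , Sb∧Ybx with Y-shape b (lookup⇒[]= x (Y b) (∧-conicalʳ _ _ Sb∧Ybx))
      ...   | inj₁ x≡base = inj₁ x≡base
      ...   | inj₂ x≡twin = inj₂ (trans x≡twin (cong twin (sym cx≡b)))
        where
        cx≡b : c x ≡ b
        cx≡b = trans (cong c x≡twin) (twin-colour b)

      base-twin-exclusive : ∀ k → base k ∈ Z → twin k ∈ Z → base k ≡ twin k
      base-twin-exclusive k base∈Z twin∈Z = contradiction odd λ ()
        where
        k∈S : k ∈ S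
        k∈S = lookup⇒[]= k S (trans (sym (lookup-Z-twin k)) ([]=⇒lookup twin∈Z))

        odd : false ≡ true
        odd = begin
          false              ≡⟨ sym (S-inEven k k∈S) ⟩
          inParity S k       ≡⟨ sym (lookup-sumSub Y S (base k)) ⟩
          lookup Z (base k)  ≡⟨ []=⇒lookup base∈Z ⟩
          true               ∎

      Z-rainbow : Rainbow c Z
      Z-rainbow = rainbow-by-sections base twin Z-shape base-twin-exclusive

      Z-dependent : Nonempty S → Dependent M Z
      Z-dependent (a , a∈S) =
        Z , ⊆-refl , (twin a , lookup⇒[]= (twin a) Z (trans (lookup-Z-twin a) ([]=⇒lookup a∈S))) ,
        trans (sumSub-sumSub M Y S) (sumSub-vanishing (sumSub M ∘ Y) S Y-zeroSum)

    independent⇒rainbowCircuit : Fin r → ∃[ C ] (Circuit M C × Rainbow c C)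
    independent⇒rainbowCircuit a₀ =
      let S , S≠∅ , S-inEven = nonempty-inEven-subset every-colour-has-successor a₀
      in rainbowDependent⇒rainbowCircuit M (Z-rainbow S-inEven) (Z-dependent S-inEven S≠∅)

  rainbowCircuit : Fin m → ∃[ C ] (Circuit M C × Rainbow c C)
  rainbowCircuit e₀ with dependent? M I
  ... | yes I-dependent   = rainbowDependent⇒rainbowCircuit M I-rainbow I-dependent
  ... | no  I-independent = independent⇒rainbowCircuit I-independent (c e₀)

corollary2 : ∀ {m n r : ℕ} (M : BinaryMatroid m n) → 1 ≤ m → Simple M →
    IsRank M r → (c : Colouring m r) → SurjectiveColouring c →
    (∀ e → ¬ ColourSingular c e) →
    ∃[ C ] (Circuit M C × Rainbow c C)
corollary2 M (s≤s _) simple (_ , rank≤) c surjective nonsingular =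
  rainbowCircuit M simple rank≤ (colourTwins surjective nonsingular) zero
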